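{- Let $N\in\mathbb N$, let $\mathcal U(12N+5)=\{(x,y)\in\mathbb Z^2:x^2+y^2=12N+5\}$, let $\mathcal B(N)=\{(q_1,q_2)\in\mathbb Z^2:3q_1^2+3q_2^2-2q_1-q_2=N\}$ and $\varphi:\mathcal B(N)\to\mathcal U(12N+5)$, $\varphi(q_1,q_2)=(6q_1-2,\,6q_2-1)$. Then: (1) the action of $D_8$ on $\mathcal U(12N+5)$ is free; (2) $\varphi(\mathcal B(N))$ is a complete set of representatives of the $D_8$-orbits of $\mathcal U(12N+5)$.
   Context: $D_8=\langle r,s\mid r^4=s^2=(rs)^2=1\rangle$ acts on integer solutions of $x^2+y^2=k$ by $r(x,y)=(-y,x)$, $s(x,y)=(y,x)$. Origin: $3q_1^2+3q_2^2-2q_1-q_2$ is the $\Lambda_0$-atomic length of the element $\sqrt2(q_1\varepsilon_1+q_2\varepsilon_2)$ of the lattice $M$ in type $D_3^{(2)}$, so $\mathcal B(N)$ parametrises affine Grassmannian elements of that type of atomic length $N$. -}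

module Defs where

open import Data.Nat using (ℕ)
open import Data.Integer using (ℤ; +_; _+_; _-_; _*_; -_)
open import Data.Fin using (Fin; zero; suc; toℕ)
open import Data.Bool using (Bool; true; false)
open import Data.Product using (_×_; _,_; Σ; ∃)
open import Relation.Binary.PropositionalEquality using (_≡_)

Pt : Set
Pt = ℤ × ℤ

rotate : Pt → Pt
rotate (x , y) = (- y , x)

swap : Pt → Pt
swap (x , y) = (y , x)

-- D_8 = ⟨ r, s ∣ r⁴ = s² = (rs)² = 1 ⟩ ; each element is uniquely r^i s^j,
-- i ∈ {0,1,2,3}, j ∈ {0,1}.
record D8 : Set where
  constructor rs
  field
    rpow : Fin 4
    spow : Bool

e : D8
e = rs zero false

rotateIter : ℕ → Pt → Pt
rotateIter ℕ.zero p = p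
rotateIter (ℕ.suc n) p = rotate (rotateIter n p)

rotateⁿ : Fin 4 → Pt → Pt
rotateⁿ i = rotateIter (toℕ i)

swapᵇ : Bool → Pt → Pt
swapᵇ false p = p
swapᵇ true p = swap p

act : D8 → Pt → Pt
act (rs i j) p = rotateⁿ i (swapᵇ j p)

InU : ℕ → Pt → Set
InU k (x , y) = x * x + y * y ≡ + k

InB : ℕ → Pt → Set
InB N (q₁ , q₂) = + 3 * (q₁ * q₁) + + 3 * (q₂ * q₂) - + 2 * q₁ - q₂ ≡ + N

φ : Pt → Pt
φ (q₁ , q₂) = (+ 6 * q₁ - + 2 , + 6 * q₂ - + 1)

SameOrbit : Pt → Pt → Set
SameOrbit u v = ∃ λ (g : D8) → act g u ≡ v

-- Reduce modulo 6.  The D₈-action commutes with reducing both coordinates mod 6, and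
-- x² + y² = 12N + 5 ≡ 5 (mod 6) leaves only the eight classes (±2, ±1), (±1, ±2), on which D₈
-- acts simply transitively.  The points of 𝒰(12N+5) in the class (−2, −1) are exactly the
-- φ(b) with b ∈ 𝓑(N), since ‖φ(b)‖ = 12·(3q₁² + 3q₂² − 2q₁ − q₂) + 5.  Freeness on the classes
-- gives (1) and (2b), transitivity gives (2a).
module Submission where

open import Defs
open import Data.Product using (_×_; _,_; ∃)
open import Relation.Binary.PropositionalEquality using (_≡_)

open import Relation.Binary.PropositionalEquality using (refl; sym; trans; cong; cong₂; subst; module ≡-Reasoning)

-- Integer arithmetic is opened only inside this module, so that _+_ and _*_ in the theorem are ℕ's.
module _ where
  open import Algebra.Properties.AbelianGroup using (∙-cancelʳ)
  open import Data.Bool as Bool using (false; true)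
  open import Data.Fin using (Fin; toℕ; fromℕ<)
  open import Data.Fin.Patterns using (0F; 1F; 2F; 3F; 4F; 5F)
  open import Data.Fin.Properties using (toℕ-fromℕ<; all?; any?) renaming (_≟_ to _≟ᶠ_)
  open import Data.Integer using (ℤ; +_; -_; _+_; _-_; _*_; 1ℤ)
  open import Data.Integer.DivMod using (_/ℕ_; n%ℕd<d; a≡a%ℕn+[a/ℕn]*n)
  open import Data.Integer.Divisibility.Signed using (_∣_; divides; _∣?_; ∣m∣n⇒∣m-n)
  open import Data.Integer.Properties using (+-comm; *-cancelˡ-≡; neg-involutive; +-0-abelianGroup)
  open import Data.Integer.Tactic.RingSolver using (solve-∀)
  open import Data.Nat using (zero; suc)
  open import Data.Nat.GeneralisedArithmetic using (fold)
  open import Data.Product.Properties using (≡-dec)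
  open import Data.Sum using (inj₁; inj₂)
  open import Relation.Nullary using (Dec)
  open import Relation.Nullary.Decidable using (map′; from-yes; _×-dec_; _⊎-dec_; _→-dec_)
  open import Relation.Binary.Definitions using (DecidableEquality)
  open ≡-Reasoning

  private
    variable
      i j : Fin 6
      x : ℤ
      u : Pt

  ‖_‖ : Pt → ℤ
  ‖ x , y ‖ = x * x + y * y

  Norm≡5[mod6] : Pt → Set
  Norm≡5[mod6] u = + 6 ∣ ‖ u ‖ + 1ℤ

  atomicLength : Pt → ℤ
  atomicLength (q₁ , q₂) = + 3 * (q₁ * q₁) + + 3 * (q₂ * q₂) - + 2 * q₁ - q₂

  norm-rotate : ∀ u → ‖ rotate u ‖ ≡ ‖ u ‖
  norm-rotate (x , y) = identity x y
    where
    identity : ∀ x y → - y * - y + x * x ≡ x * x + y * y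
    identity = solve-∀

  norm-rotateIter : ∀ m u → ‖ rotateIter m u ‖ ≡ ‖ u ‖
  norm-rotateIter zero    u = refl
  norm-rotateIter (suc m) u = trans (norm-rotate (rotateIter m u)) (norm-rotateIter m u)

  norm-act : ∀ g u → ‖ act g u ‖ ≡ ‖ u ‖
  norm-act (rs i false) u       = norm-rotateIter (toℕ i) u
  norm-act (rs i true)  (x , y) = trans (norm-rotateIter (toℕ i) (y , x)) (+-comm (y * y) (x * x))

  _⁻¹ : D8 → D8
  rs 0F false ⁻¹ = rs 0F false
  rs 1F false ⁻¹ = rs 3F false
  rs 2F false ⁻¹ = rs 2F false
  rs 3F false ⁻¹ = rs 1F false
  rs i  true  ⁻¹ = rs i true

  act-inverse : ∀ g u → act (g ⁻¹) (act g u) ≡ u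
  act-inverse (rs 0F false) u       = refl
  act-inverse (rs 1F false) (x , y) = cong₂ _,_ (neg-involutive x) (neg-involutive y)
  act-inverse (rs 2F false) (x , y) = cong₂ _,_ (neg-involutive x) (neg-involutive y)
  act-inverse (rs 3F false) (x , y) = cong₂ _,_ (neg-involutive x) (neg-involutive y)
  act-inverse (rs 0F true)  u       = refl
  act-inverse (rs 1F true)  (x , y) = cong (_, y) (neg-involutive x)
  act-inverse (rs 2F true)  (x , y) = cong₂ _,_ (neg-involutive x) (neg-involutive y)
  act-inverse (rs 3F true)  (x , y) = cong₂ _,_ (trans (neg-involutive _) (neg-involutive x)) (neg-involutive y)

  HasResidue : Fin 6 → ℤ → Set
  HasResidue i x = ∃ λ k → x ≡ + toℕ i + k * + 6

  Residues : Set
  Residues = Fin 6 × Fin 6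

  HasResidues : Residues → Pt → Set
  HasResidues (i , j) (x , y) = HasResidue i x × HasResidue j y

  embed : Residues → Pt
  embed (i , j) = + toℕ i , + toℕ j

  residue : ∀ x → ∃ λ i → HasResidue i x
  residue x = fromℕ< (n%ℕd<d x 6) , x /ℕ 6 ,
    trans (a≡a%ℕn+[a/ℕn]*n x 6) (cong (λ r → + r + x /ℕ 6 * + 6) (sym (toℕ-fromℕ< (n%ℕd<d x 6))))

  residues : ∀ u → ∃ λ ρ → HasResidues ρ u
  residues (x , y) with residue x | residue y
  ... | i , rx | j , ry = (i , j) , rx , ry

  neg₆ : Fin 6 → Fin 6
  neg₆ 0F = 0F
  neg₆ 1F = 5F
  neg₆ 2F = 4F
  neg₆ 3F = 3F
  neg₆ 4F = 2F
  neg₆ 5F = 1F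

  rotate₆ : Residues → Residues
  rotate₆ (i , j) = neg₆ j , i

  act₆ : D8 → Residues → Residues
  act₆ (rs i false) ρ = fold ρ rotate₆ (toℕ i)
  act₆ (rs i true)  (i′ , j′) = fold (j′ , i′) rotate₆ (toℕ i)

  negate-zero : ∀ k → - (+ 0 + k * + 6) ≡ + 0 + - k * + 6
  negate-zero = solve-∀

  -- For a literal c, + 6 - c computes to a literal, so this one identity serves every nonzero
  -- residue below, and likewise φ-coordinate serves both coordinates of φ.
  negate-nonzero : ∀ c k → - (c + k * + 6) ≡ (+ 6 - c) + (- k - 1ℤ) * + 6
  negate-nonzero = solve-∀

  neg-residue : HasResidue i x → HasResidue (neg₆ i) (- x)
  neg-residue {0F} (k , refl) = - k , negate-zero k
  neg-residue {1F} (k , refl) = - k - 1ℤ , negate-nonzero (+ 1) k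
  neg-residue {2F} (k , refl) = - k - 1ℤ , negate-nonzero (+ 2) k
  neg-residue {3F} (k , refl) = - k - 1ℤ , negate-nonzero (+ 3) k
  neg-residue {4F} (k , refl) = - k - 1ℤ , negate-nonzero (+ 4) k
  neg-residue {5F} (k , refl) = - k - 1ℤ , negate-nonzero (+ 5) k

  rotate-residues : ∀ {ρ} u → HasResidues ρ u → HasResidues (rotate₆ ρ) (rotate u)
  rotate-residues _ (rx , ry) = neg-residue ry , rx

  rotateIter-residues : ∀ m {ρ} u → HasResidues ρ u → HasResidues (fold ρ rotate₆ m) (rotateIter m u)
  rotateIter-residues zero    u r = r
  rotateIter-residues (suc m) u r = rotate-residues (rotateIter m u) (rotateIter-residues m u r)

  act-residues : ∀ g {ρ} u → HasResidues ρ u → HasResidues (act₆ g ρ) (act g u)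
  act-residues (rs i false) u       r         = rotateIter-residues (toℕ i) u r
  act-residues (rs i true)  (x , y) (rx , ry) = rotateIter-residues (toℕ i) (y , x) (ry , rx)

  D8-≟ : DecidableEquality D8
  D8-≟ (rs i b) (rs j c) = map′ (λ { (refl , refl) → refl }) (λ { refl → refl , refl }) ((i ≟ᶠ j) ×-dec (b Bool.≟ c))

  residues-≟ : DecidableEquality Residues
  residues-≟ = ≡-dec _≟ᶠ_ _≟ᶠ_

  all-D8? : {P : D8 → Set} → (∀ g → Dec (P g)) → Dec (∀ g → P g)
  all-D8? P? = map′ (λ h g → h (D8.rpow g) (D8.spow g)) (λ h i b → h (rs i b))
    (all? λ i → map′ (λ { (f , t) false → f ; (f , t) true → t }) (λ h → h false , h true)
                     (P? (rs i false) ×-dec P? (rs i true)))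

  any-D8? : {P : D8 → Set} → (∀ g → Dec (P g)) → Dec (∃ P)
  any-D8? P? = map′ (λ { (i , inj₁ p) → rs i false , p ; (i , inj₂ p) → rs i true , p })
                    (λ { (rs i false , p) → i , inj₁ p ; (rs i true , p) → i , inj₂ p })
    (any? λ i → P? (rs i false) ⊎-dec P? (rs i true))

  norm5? : ∀ ρ → Dec (Norm≡5[mod6] (embed ρ))
  norm5? ρ = + 6 ∣? ‖ embed ρ ‖ + 1ℤ

  class-φ : Residues
  class-φ = 4F , 5F

  -- Finite checks, decided by evaluation; opaque so that type checking never unfolds them again.
  opaque
    residue-unique-Fin : ∀ (i j : Fin 6) → + 6 ∣ + toℕ i - + toℕ j → i ≡ j
    residue-unique-Fin = from-yes (all? λ (i : Fin 6) → all? λ (j : Fin 6) →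
      (+ 6 ∣? + toℕ i - + toℕ j) →-dec (i ≟ᶠ j))

    norm5-reaches-class-φ : ∀ ρ → Norm≡5[mod6] (embed ρ) → ∃ λ g → act₆ g ρ ≡ class-φ
    norm5-reaches-class-φ (i , j) = from-yes (all? λ (i : Fin 6) → all? λ (j : Fin 6) →
      norm5? (i , j) →-dec any-D8? λ g → residues-≟ (act₆ g (i , j)) class-φ) i j

    act₆-free-on-norm5 : ∀ ρ g → Norm≡5[mod6] (embed ρ) → act₆ g ρ ≡ ρ → g ≡ e
    act₆-free-on-norm5 (i , j) = from-yes (all? λ (i : Fin 6) → all? λ (j : Fin 6) → all-D8? λ g →
      norm5? (i , j) →-dec residues-≟ (act₆ g (i , j)) (i , j) →-dec D8-≟ g e) i j

  difference-of-shifts : ∀ a c k l → a + k * + 6 ≡ c + l * + 6 → a - c ≡ (l - k) * + 6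
  difference-of-shifts a c k l eq = begin
    a - c                                           ≡⟨ expand a c k l ⟩
    (a + k * + 6) - (c + l * + 6) + (l - k) * + 6   ≡⟨ cong (λ z → z - (c + l * + 6) + (l - k) * + 6) eq ⟩
    (c + l * + 6) - (c + l * + 6) + (l - k) * + 6   ≡⟨ cancel (c + l * + 6) ((l - k) * + 6) ⟩
    (l - k) * + 6                                   ∎
    where
    expand : ∀ a c k l → a - c ≡ (a + k * + 6) - (c + l * + 6) + (l - k) * + 6
    expand = solve-∀
    cancel : ∀ z w → z - z + w ≡ w
    cancel = solve-∀

  residue-unique : HasResidue i x → HasResidue j x → i ≡ j
  residue-unique {i} {j = j} (k , refl) (l , eq) =
    residue-unique-Fin i j (divides (l - k) (difference-of-shifts (+ toℕ i) (+ toℕ j) k l eq))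

  residues-unique : ∀ {ρ σ} → HasResidues ρ u → HasResidues σ u → ρ ≡ σ
  residues-unique (rx , ry) (sx , sy) = cong₂ _,_ (residue-unique rx sx) (residue-unique ry sy)

  norm-congruence : ∀ {ρ} u → HasResidues ρ u → + 6 ∣ ‖ u ‖ - ‖ embed ρ ‖
  norm-congruence {i , j} _ ((k , refl) , (l , refl)) =
    divides (+ 2 * + toℕ i * k + + 6 * k * k + + 2 * + toℕ j * l + + 6 * l * l)
            (square-shift (+ toℕ i) (+ toℕ j) k l)
    where
    square-shift : ∀ a c k l → ((a + k * + 6) * (a + k * + 6) + (c + l * + 6) * (c + l * + 6)) - (a * a + c * c)
                             ≡ (+ 2 * a * k + + 6 * k * k + + 2 * c * l + + 6 * l * l) * + 6
    square-shift = solve-∀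

  norm5-residues : ∀ {ρ} → Norm≡5[mod6] u → HasResidues ρ u → Norm≡5[mod6] (embed ρ)
  norm5-residues {u} {ρ} 6∣u r = subst (+ 6 ∣_) (shift ‖ u ‖ ‖ embed ρ ‖) (∣m∣n⇒∣m-n 6∣u (norm-congruence u r))
    where
    shift : ∀ a c → (a + 1ℤ) - (a - c) ≡ c + 1ℤ
    shift = solve-∀

  φ-coordinate : ∀ c q → + 6 * q - c ≡ (+ 6 - c) + (q - 1ℤ) * + 6
  φ-coordinate = solve-∀

  φ-coordinate′ : ∀ c k → + 6 * (k + 1ℤ) - c ≡ (+ 6 - c) + k * + 6
  φ-coordinate′ = solve-∀

  φ-residues : ∀ b → HasResidues class-φ (φ b)
  φ-residues (q₁ , q₂) = (q₁ - 1ℤ , φ-coordinate (+ 2) q₁) , (q₂ - 1ℤ , φ-coordinate (+ 1) q₂)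

  class-φ-is-φ : HasResidues class-φ u → ∃ λ b → φ b ≡ u
  class-φ-is-φ ((k , refl) , (l , refl)) =
    (k + 1ℤ , l + 1ℤ) , cong₂ _,_ (φ-coordinate′ (+ 2) k) (φ-coordinate′ (+ 1) l)

  class-φ-norm5 : Norm≡5[mod6] (embed class-φ)
  class-φ-norm5 = divides (+ 7) refl

  norm-φ : ∀ b → ‖ φ b ‖ ≡ + 12 * atomicLength b + + 5
  norm-φ (q₁ , q₂) = identity q₁ q₂
    where
    identity : ∀ q₁ q₂ → (+ 6 * q₁ - + 2) * (+ 6 * q₁ - + 2) + (+ 6 * q₂ - + 1) * (+ 6 * q₂ - + 1)
                       ≡ + 12 * (+ 3 * (q₁ * q₁) + + 3 * (q₂ * q₂) - + 2 * q₁ - q₂) + + 5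
    identity = solve-∀

  atomicLength-from-norm : ∀ b n → ‖ φ b ‖ ≡ + 12 * n + + 5 → atomicLength b ≡ n
  atomicLength-from-norm b n eq =
    *-cancelˡ-≡ (+ 12) _ _ (∙-cancelʳ +-0-abelianGroup (+ 5) _ _ (trans (sym (norm-φ b)) eq))

  norm5-if-12n+5 : ∀ u n → ‖ u ‖ ≡ + 12 * n + + 5 → Norm≡5[mod6] u
  norm5-if-12n+5 u n eq = divides (+ 2 * n + 1ℤ) (trans (cong (_+ 1ℤ) eq) (identity n))
    where
    identity : ∀ n → + 12 * n + + 5 + 1ℤ ≡ (+ 2 * n + 1ℤ) * + 6
    identity = solve-∀

  act-free : ∀ g u → Norm≡5[mod6] u → act g u ≡ u → g ≡ e
  act-free g u norm5 fixed =
    let ρ , r = residues u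
    in act₆-free-on-norm5 ρ g (norm5-residues norm5 r)
         (residues-unique (subst (HasResidues _) fixed (act-residues g u r)) r)

  orbit-meets-φ : ∀ u → Norm≡5[mod6] u → ∃ λ b → SameOrbit (φ b) u
  orbit-meets-φ u norm5 =
    let ρ , r  = residues u
        g , gρ = norm5-reaches-class-φ ρ (norm5-residues norm5 r)
        b , φb≡gu = class-φ-is-φ (subst (λ σ → HasResidues σ (act g u)) gρ (act-residues g u r))
    in b , g ⁻¹ , (begin
      act (g ⁻¹) (φ b)         ≡⟨ cong (act (g ⁻¹)) φb≡gu ⟩
      act (g ⁻¹) (act g u)     ≡⟨ act-inverse g u ⟩
      u                        ∎)

  orbit-meets-φ-at-most-once : ∀ b b′ → SameOrbit (φ b) (φ b′) → φ b ≡ φ b′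
  orbit-meets-φ-at-most-once b b′ (g , eq)
    with act₆-free-on-norm5 class-φ g class-φ-norm5
           (residues-unique (subst (HasResidues _) eq (act-residues g (φ b) (φ-residues b))) (φ-residues b′))
  ... | refl = eq

  same-orbit-norm : ∀ v u → SameOrbit v u → ‖ v ‖ ≡ ‖ u ‖
  same-orbit-norm v u (g , eq) = trans (sym (norm-act g v)) (cong ‖_‖ eq)

open import Data.Nat using (ℕ; _+_; _*_)
open import Data.Integer as ℤ using (+_)
open import Data.Integer.Properties using (pos-+; pos-*)

12N+5-in-ℤ : ∀ N → + (12 * N + 5) ≡ + 12 ℤ.* + N ℤ.+ + 5
12N+5-in-ℤ N = trans (pos-+ (12 * N) 5) (cong (ℤ._+ + 5) (pos-* 12 N))

theorem8p17 : (N : ℕ) →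
    -- φ maps 𝓑(N) into 𝒰(12N+5)
    (∀ b → InB N b → InU (12 * N + 5) (φ b))
    -- (1) the D_8-action on 𝒰(12N+5) is free
    × (∀ (g : D8) u → InU (12 * N + 5) u → act g u ≡ u → g ≡ e)
    -- (2a) every orbit of 𝒰(12N+5) meets φ(𝓑(N))
    × (∀ u → InU (12 * N + 5) u → ∃ λ b → InB N b × SameOrbit (φ b) u)
    -- (2b) it meets φ(𝓑(N)) in at most one point
    × (∀ b b′ → InB N b → InB N b′ → SameOrbit (φ b) (φ b′) → φ b ≡ φ b′)
theorem8p17 N =
    (λ b b∈B → trans (norm-φ b) (trans (cong (λ ℓ → + 12 ℤ.* ℓ ℤ.+ + 5) b∈B) (sym (12N+5-in-ℤ N))))
  , (λ g u u∈U → act-free g u (norm5-if-12n+5 u (+ N) (trans u∈U (12N+5-in-ℤ N))))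
  , (λ u u∈U → let norm≡ = trans u∈U (12N+5-in-ℤ N)
                   b , o  = orbit-meets-φ u (norm5-if-12n+5 u (+ N) norm≡)
               in b , atomicLength-from-norm b (+ N) (trans (same-orbit-norm (φ b) u o) norm≡) , o)
  , (λ b b′ _ _ → orbit-meets-φ-at-most-once b b′)
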